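{- Let $p,q$ be positive integers, let $F$ be a spanning subgraph of $K_{p,q}$, and let $G$ be a finite simple bipartite graph. (1) If $p,q\ge2$, then $\hom(F,G)\ge\hom(K_{p,q},G)+(pq-|E(F)|)\,\eta_{p,q}(G)$. (2) If $p=1$ or $q=1$, then $\hom(F,G)=|V(G)|^{pq-|E(F)|}\sum_{v\in V(G)}d_G(v)^{|E(F)|}$ (with $0^0=1$).
   Context: $\hom(F,G)$ is the number of maps $\phi:V(F)\to V(G)$ sending every edge of $F$ to an edge of $G$. $K_{p,q}$ is the complete bipartite graph with partite sets of sizes $p$ and $q$; a spanning subgraph has the same vertex set. $d_G(v)$ is the degree of $v$ and $\mathcal{N}_G(x)$ the neighbourhood of $x$ in $G$. Let $\mathcal{D}=\{(u,v)\in V(G)\times V(G):\ \{u,v\}\notin E(G),\ \exists\, w\in\mathcal{N}_G(u)\text{ with }\mathcal{N}_G(v)\cap\mathcal{N}_G(w)\ne\emptyset\}$ and $\eta_{p,q}(G)=\sum_{(u,v)\in\mathcal{D}}\sum_{w\in\mathcal{N}_G(u):\ \mathcal{N}_G(v)\cap\mathcal{N}_G(w)\neq\emptyset}|\mathcal{N}_G(v)\cap\mathcal{N}_G(w)|^{\max\{p,q\}-1}$. -}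

module Defs where

open import Data.Nat using (ℕ; zero; suc; _+_; _*_; _∸_; _^_; _<ᵇ_; _⊔_)
open import Data.Bool using (Bool; true; false; not; _∧_; _∨_; _xor_; if_then_else_)
open import Data.Fin using (Fin; toℕ)
open import Data.Vec using (Vec; []; _∷_; lookup)
open import Data.List using (List; []; _∷_; [_]; map; concatMap; allFin; length; filterᵇ)
open import Data.Nat.ListAction using (sum)
open import Data.Bool.ListAction using (and; or)
open import Data.Product using (∃; _×_)
open import Relation.Binary.PropositionalEquality using (_≡_; _≢_; refl)

record Graph (n : ℕ) : Set where
  field
    adj    : Fin n → Fin n → Bool
    sym    : ∀ u v → adj u v ≡ adj v u
    irrefl : ∀ v → adj v v ≡ false
open Graph public

IsBipartite : ∀ {n} → Graph n → Set
IsBipartite {n} G = ∃ λ (col : Fin n → Bool) → ∀ u v → adj G u v ≡ true → col u ≢ col v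

count : ∀ {A : Set} → (A → Bool) → List A → ℕ
count P xs = length (filterᵇ P xs)

Σv : (n : ℕ) → (Fin n → ℕ) → ℕ
Σv n f = sum (map f (allFin n))

allMaps : (k n : ℕ) → List (Vec (Fin n) k)
allMaps zero    n = [ [] ]
allMaps (suc k) n = concatMap (λ x → map (x ∷_) (allMaps k n)) (allFin n)

isHom : ∀ {k n} → Graph k → Graph n → Vec (Fin n) k → Bool
isHom {k} F G φ =
  and (map (λ u → and (map (λ v → not (adj F u v) ∨ adj G (lookup φ u) (lookup φ v)) (allFin k))) (allFin k))

hom : ∀ {k n} → Graph k → Graph n → ℕ
hom {k} {n} F G = count (isHom F G) (allMaps k n)

[_]ᵇ : Bool → ℕ
[ b ]ᵇ = if b then 1 else 0

edgeCount : ∀ {n} → Graph n → ℕ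
edgeCount {n} F = Σv n (λ u → Σv n (λ v → [ (toℕ u <ᵇ toℕ v) ∧ adj F u v ]ᵇ))

deg : ∀ {n} → Graph n → Fin n → ℕ
deg {n} G v = count (adj G v) (allFin n)

commonNbrs : ∀ {n} → Graph n → Fin n → Fin n → ℕ
commonNbrs {n} G v w = count (λ x → adj G v x ∧ adj G w x) (allFin n)

-- K_{p,q} on vertex set Fin (p + q); the first p vertices form one side.
private
  xor-self : ∀ b → b xor b ≡ false
  xor-self true  = refl
  xor-self false = refl

  xor-comm : ∀ a b → a xor b ≡ b xor a
  xor-comm true  true  = refl
  xor-comm true  false = refl
  xor-comm false true  = refl
  xor-comm false false = refl

K : (p q : ℕ) → Graph (p + q)
K p q = record
  { adj    = λ u v → (toℕ u <ᵇ p) xor (toℕ v <ᵇ p)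
  ; sym    = λ u v → xor-comm (toℕ u <ᵇ p) (toℕ v <ᵇ p)
  ; irrefl = λ v → xor-self (toℕ v <ᵇ p)
  }

SpanningSubgraph : ∀ {n} → Graph n → Graph n → Set
SpanningSubgraph {n} F H = ∀ (u v : Fin n) → adj F u v ≡ true → adj H u v ≡ true

inD : ∀ {n} → Graph n → Fin n → Fin n → Bool
inD {n} G u v = not (adj G u v) ∧
  or (map (λ w → adj G u w ∧ (0 <ᵇ commonNbrs G v w)) (allFin n))

η : ∀ {n} → ℕ → ℕ → Graph n → ℕ
η {n} p q G = Σv n (λ u → Σv n (λ v → if inD G u v then
  Σv n (λ w → if adj G u w ∧ (0 <ᵇ commonNbrs G v w)
              then commonNbrs G v w ^ ((p ⊔ q) ∸ 1) else 0)
  else 0))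

{-# OPTIONS --safe #-}
module Submission where

-- (1) For an edge ab of K_{p,q}, call φ ab-breaking if it maps every other edge of K_{p,q} to an
-- edge of G but ab to a non-edge.  When ab ∉ E(F), every ab-breaking map is a homomorphism of F
-- and not of K_{p,q}, and it determines ab; so hom(F,G) ≥ hom(K_{p,q},G) + Σ_{ab ∉ E(F)} #(ab-breaking).
-- Put a on the side of size max{p,q} and pick b′ ≠ b on the other side.  For u ≁ v and w ∈ N(u),
-- the maps with a ↦ u, b ↦ v, the rest of b's side ↦ w and the rest of a's side into N(v) ∩ N(w)
-- are ab-breaking, and u, v, w = φ(a), φ(b), φ(b′) are recovered from φ.  Hence there are at least
-- Σ_{u≁v} Σ_{w∈N(u)} |N(v) ∩ N(w)|^(max{p,q}−1) ≥ η_{p,q}(G) ab-breaking maps.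
--
-- (2) A spanning subgraph F of K 1 q or K p 1 is a star with centre c together with isolated
-- vertices, and |E(F)| = d_F(c).  A homomorphism is an image x of c, images in N(x) for the
-- |E(F)| leaves and arbitrary images for the pq − |E(F)| isolated vertices.

open import Defs renaming (sym to adj-sym)
open import Data.Bool using (Bool; true; false; not; _∧_; _∨_; _xor_; if_then_else_)
open import Data.Bool.Properties using (∧-zeroʳ; ∧-identityʳ)
open import Data.Bool.ListAction using (and; all)
open import Data.Fin using (Fin; zero; suc; toℕ; _≟_; _↑ʳ_)
open import Data.Fin.Properties using (toℕ-injective; suc-injective; ↑ʳ-injective)
open import Data.List using (List; []; _∷_; _++_; map; concatMap; allFin; length)
open import Data.List.Properties using (map-cong; map-++; map-∘; map-tabulate; length-tabulate)
open import Data.Nat using (ℕ; zero; suc; _+_; _*_; _∸_; _^_; _⊔_; _≤_; _≥_; _<_; _<?_; _<ᵇ_; z≤n; s≤s)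
open import Data.Nat.ListAction using (sum; product)
open import Data.Nat.ListAction.Properties using (sum-++)
open import Data.Nat.Properties
  using ( +-identityʳ; +-mono-≤; +-monoˡ-≤; +-monoʳ-≤; +-cancelˡ-≡; +-commutativeSemigroup
        ; *-comm; *-zeroʳ; *-identityˡ; *-identityʳ; *-distribˡ-+; *-cancelˡ-≡; [m*n]*[o*p]≡[m*o]*[n*p]
        ; ≤-refl; ≤-reflexive; ≤-trans; ≤-total; ≮⇒≥; n≤0⇒n≡0; m+n∸m≡n; m+n∸n≡m; m≥n⇒m⊔n≡m; m≤n⇒m⊔n≡n
        ; module ≤-Reasoning)
open import Algebra.Properties.CommutativeSemigroup +-commutativeSemigroup using (interchange)
open import Data.Product using (∃; _×_; _,_; proj₁; proj₂)
import Data.Product as Product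
import Data.Sum as Sum
open import Data.Sum using (_⊎_; inj₁; inj₂)
open import Data.Vec using (Vec; _∷_; lookup)
open import Function using (_∘_; mk⇔)
open import Relation.Binary.PropositionalEquality
open import Relation.Nullary using (Dec; yes; no; does; ¬_; contradiction)
open import Relation.Nullary.Decidable using (dec-true; dec-false; does-⇔; _×-dec_; _⊎-dec_)

private variable
  A B : Set
  P Q : A → Bool
  k n : ℕ

∧-true⁻ : ∀ {a b} → a ∧ b ≡ true → a ≡ true × b ≡ true
∧-true⁻ {true} {true} _ = refl , refl

not-true⁻ : ∀ {a} → not a ≡ true → a ≡ false
not-true⁻ {false} _ = refl

xor-true⁻ : ∀ {a b} → a xor b ≡ true → a ≡ not b
xor-true⁻ {true}  {false} _ = refl
xor-true⁻ {false} {true}  _ = refl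

not∨-elim : ∀ {a b} → not a ∨ b ≡ true → a ≡ true → b ≡ true
not∨-elim {true} b refl = b

not∨-intro : ∀ {a b} → (a ≡ true → b ≡ true) → not a ∨ b ≡ true
not∨-intro {false} a⇒b = refl
not∨-intro {true}  a⇒b = a⇒b refl

≡true-ext : ∀ {a b} → (a ≡ true → b ≡ true) → (b ≡ true → a ≡ true) → a ≡ b
≡true-ext {false} {false} _   _   = refl
≡true-ext {false} {true}  _   b⇒a = b⇒a refl
≡true-ext {true}  {b}     a⇒b _   = sym (a⇒b refl)

[]ᵇ-split : ∀ a b → [ a ]ᵇ ≡ [ a ∧ b ]ᵇ + [ a ∧ not b ]ᵇ
[]ᵇ-split true  true  = refl
[]ᵇ-split true  false = refl
[]ᵇ-split false b     = refl

[]ᵇ-mono : ∀ {a b} → (a ≡ true → b ≡ true) → [ a ]ᵇ ≤ [ b ]ᵇ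
[]ᵇ-mono {false} a⇒b = z≤n
[]ᵇ-mono {true}  a⇒b rewrite a⇒b refl = ≤-refl

[]ᵇ>0⇒ : ∀ {b} → 0 < [ b ]ᵇ → b ≡ true
[]ᵇ>0⇒ {true} _ = refl

[]ᵇ≤1 : ∀ b → [ b ]ᵇ ≤ 1
[]ᵇ≤1 true  = ≤-refl
[]ᵇ≤1 false = z≤n

[]ᵇ*-mono : ∀ {b m m′} → (b ≡ true → m ≤ m′) → [ b ]ᵇ * m ≤ [ b ]ᵇ * m′
[]ᵇ*-mono {false} _    = z≤n
[]ᵇ*-mono {true}  m≤m′ = +-monoˡ-≤ 0 (m≤m′ refl)

-- Finite sums, products and counts

∑ : List A → (A → ℕ) → ℕ
∑ xs f = sum (map f xs)

∑-cong : ∀ (xs : List A) {f g : A → ℕ} → (∀ x → f x ≡ g x) → ∑ xs f ≡ ∑ xs g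
∑-cong xs f≗g = cong sum (map-cong f≗g xs)

∑-mono : ∀ (xs : List A) {f g : A → ℕ} → (∀ x → f x ≤ g x) → ∑ xs f ≤ ∑ xs g
∑-mono []       f≤g = z≤n
∑-mono (x ∷ xs) f≤g = +-mono-≤ (f≤g x) (∑-mono xs f≤g)

∑-zero : ∀ (xs : List A) {f : A → ℕ} → (∀ x → f x ≡ 0) → ∑ xs f ≡ 0
∑-zero []       f≗0 = refl
∑-zero (x ∷ xs) f≗0 = cong₂ _+_ (f≗0 x) (∑-zero xs f≗0)

∑-+ : ∀ (xs : List A) (f g : A → ℕ) → ∑ xs (λ x → f x + g x) ≡ ∑ xs f + ∑ xs g
∑-+ []       f g = refl
∑-+ (x ∷ xs) f g =
  trans (cong (f x + g x +_) (∑-+ xs f g)) (interchange (f x) (g x) (∑ xs f) (∑ xs g))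

∑-*ˡ : ∀ (xs : List A) (c : ℕ) (f : A → ℕ) → ∑ xs (λ x → c * f x) ≡ c * ∑ xs f
∑-*ˡ []       c f = sym (*-zeroʳ c)
∑-*ˡ (x ∷ xs) c f = trans (cong (c * f x +_) (∑-*ˡ xs c f)) (sym (*-distribˡ-+ c (f x) (∑ xs f)))

∑-*ʳ : ∀ (xs : List A) (c : ℕ) (f : A → ℕ) → ∑ xs (λ x → f x * c) ≡ ∑ xs f * c
∑-*ʳ xs c f = trans (∑-cong xs (λ x → *-comm (f x) c)) (trans (∑-*ˡ xs c f) (*-comm c (∑ xs f)))

∑-map : ∀ (xs : List B) (g : B → A) (f : A → ℕ) → ∑ (map g xs) f ≡ ∑ xs (f ∘ g)
∑-map xs g f = cong sum (sym (map-∘ xs))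

∑-concatMap : ∀ (xs : List B) (g : B → List A) (f : A → ℕ) →
              ∑ (concatMap g xs) f ≡ ∑ xs (λ x → ∑ (g x) f)
∑-concatMap []       g f = refl
∑-concatMap (x ∷ xs) g f = begin
  sum (map f (g x ++ concatMap g xs))          ≡⟨ cong sum (map-++ f (g x) (concatMap g xs)) ⟩
  sum (map f (g x) ++ map f (concatMap g xs))  ≡⟨ sum-++ (map f (g x)) _ ⟩
  ∑ (g x) f + ∑ (concatMap g xs) f             ≡⟨ cong (∑ (g x) f +_) (∑-concatMap xs g f) ⟩
  ∑ (g x) f + ∑ xs (λ y → ∑ (g y) f)           ∎
  where open ≡-Reasoning

∑-swap : ∀ (xs : List A) (ys : List B) (f : A → B → ℕ) →
         ∑ xs (λ x → ∑ ys (f x)) ≡ ∑ ys (λ y → ∑ xs (λ x → f x y))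
∑-swap []       ys f = sym (∑-zero ys (λ _ → refl))
∑-swap (x ∷ xs) ys f = trans (cong (∑ ys (f x) +_) (∑-swap xs ys f)) (sym (∑-+ ys (f x) _))

∏ : List A → (A → ℕ) → ℕ
∏ xs f = product (map f xs)

∏-* : ∀ (xs : List A) (f g : A → ℕ) → ∏ xs (λ x → f x * g x) ≡ ∏ xs f * ∏ xs g
∏-* []       f g = refl
∏-* (x ∷ xs) f g =
  trans (cong (f x * g x *_) (∏-* xs f g)) ([m*n]*[o*p]≡[m*o]*[n*p] (f x) (g x) (∏ xs f) (∏ xs g))

∏-if-^ : ∀ (xs : List A) (P : A → Bool) (d : ℕ) → ∏ xs (λ x → if P x then d else 1) ≡ d ^ count P xs
∏-if-^ []       P d = refl
∏-if-^ (x ∷ xs) P d with P x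
... | true  = cong (d *_) (∏-if-^ xs P d)
... | false = trans (+-identityʳ _) (∏-if-^ xs P d)

map-allFin-suc : ∀ (f : Fin (suc n) → A) → map f (allFin (suc n)) ≡ f zero ∷ map (f ∘ suc) (allFin n)
map-allFin-suc f =
  cong (f zero ∷_) (trans (map-tabulate suc f) (sym (map-tabulate (λ i → i) (f ∘ suc))))

Σv-suc : ∀ (f : Fin (suc n) → ℕ) → Σv (suc n) f ≡ f zero + Σv n (f ∘ suc)
Σv-suc f = cong sum (map-allFin-suc f)

Σv-single : ∀ {f : Fin n → ℕ} (c : Fin n) → (∀ x → x ≢ c → f x ≡ 0) → Σv n f ≡ f c
Σv-single {suc n} {f} zero f≗0 = begin
  Σv (suc n) f              ≡⟨ Σv-suc f ⟩
  f zero + Σv n (f ∘ suc)   ≡⟨ cong (f zero +_) (∑-zero (allFin n) (λ x → f≗0 (suc x) λ ())) ⟩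
  f zero + 0                ≡⟨ +-identityʳ (f zero) ⟩
  f zero                    ∎
  where open ≡-Reasoning
Σv-single {suc n} {f} (suc c) f≗0 = begin
  Σv (suc n) f              ≡⟨ Σv-suc f ⟩
  f zero + Σv n (f ∘ suc)
    ≡⟨ cong₂ _+_ (f≗0 zero λ ()) (Σv-single c λ x x≢c → f≗0 (suc x) (x≢c ∘ suc-injective)) ⟩
  f (suc c)                 ∎
  where open ≡-Reasoning

Σv-positive : ∀ (f : Fin n → ℕ) → 0 < Σv n f → ∃ λ x → 0 < f x
Σv-positive {suc n} f pos with 0 <? f zero
... | yes f0>0 = zero , f0>0
... | no  f0≯0 = let x , fx>0 = Σv-positive (f ∘ suc) (subst (0 <_) drop-head pos) in suc x , fx>0
  where
  drop-head : Σv (suc n) f ≡ Σv n (f ∘ suc)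
  drop-head = trans (Σv-suc f) (cong (_+ Σv n (f ∘ suc)) (n≤0⇒n≡0 (≮⇒≥ f0≯0)))

Σv-≤1 : ∀ (f : Fin n → ℕ) → (∀ x → f x ≤ 1) → (∀ x y → 0 < f x → 0 < f y → x ≡ y) →
        Σv n f ≤ 1
Σv-≤1 {n} f f≤1 unique with 0 <? Σv n f
... | no  Σ≯0 = ≤-trans (≮⇒≥ Σ≯0) z≤n
... | yes Σ>0 with Σv-positive f Σ>0
... | x , fx>0 = subst (_≤ 1) (sym (Σv-single x others)) (f≤1 x)
  where
  others : ∀ y → y ≢ x → f y ≡ 0
  others y y≢x = n≤0⇒n≡0 (≮⇒≥ λ fy>0 → y≢x (unique y x fy>0 fx>0))

_==_ : Fin n → Fin n → Bool
i == j = does (i ≟ j)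

==-refl : ∀ (i : Fin n) → (i == i) ≡ true
==-refl i = dec-true (i ≟ i) refl

==-≢ : ∀ {i j : Fin n} → i ≢ j → (i == j) ≡ false
==-≢ {i = i} {j} = dec-false (i ≟ j)

==⇒≡ : ∀ {i j : Fin n} → (i == j) ≡ true → i ≡ j
==⇒≡ {i = i} {j} eq with i ≟ j
... | yes i≡j = i≡j

≡⇒== : ∀ {i j : Fin n} → i ≡ j → (i == j) ≡ true
≡⇒== {i = i} refl = ==-refl i

Σv-delta : ∀ (z : Fin n) (P : Fin n → Bool) → Σv n (λ y → [ (y == z) ∧ P y ]ᵇ) ≡ [ P z ]ᵇ
Σv-delta z P = trans (Σv-single z λ y y≢z → cong (λ b → [ b ∧ P y ]ᵇ) (==-≢ y≢z))
                     (cong (λ b → [ b ∧ P z ]ᵇ) (==-refl z))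

Σv²-[]ᵇ-≤ : ∀ {m} (P : Fin m → Fin n → Bool) {q} →
  (∀ a b → P a b ≡ true → q ≡ true) →
  (∀ a b a′ b′ → P a b ≡ true → P a′ b′ ≡ true → a ≡ a′ × b ≡ b′) →
  Σv m (λ a → Σv n (λ b → [ P a b ]ᵇ)) ≤ [ q ]ᵇ
Σv²-[]ᵇ-≤ {n} {m} P {false} P⇒q unique =
  ≤-reflexive (∑-zero (allFin m) λ a → ∑-zero (allFin n) (absent a))
  where
  absent : ∀ a b → [ P a b ]ᵇ ≡ 0
  absent a b with P a b in Pab
  ... | false = refl
  ... | true  = contradiction (P⇒q a b Pab) λ ()
Σv²-[]ᵇ-≤ {n} P {true} P⇒q unique = Σv-≤1 _ row≤1 rows-unique
  where
  row≤1 : ∀ a → Σv n (λ b → [ P a b ]ᵇ) ≤ 1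
  row≤1 a = Σv-≤1 _ (λ b → []ᵇ≤1 (P a b))
                    λ b b′ p p′ → proj₂ (unique a b a b′ ([]ᵇ>0⇒ p) ([]ᵇ>0⇒ p′))
  rows-unique : ∀ a a′ → 0 < Σv n (λ b → [ P a b ]ᵇ) → 0 < Σv n (λ b → [ P a′ b ]ᵇ) → a ≡ a′
  rows-unique a a′ pos pos′ with Σv-positive _ pos | Σv-positive _ pos′
  ... | b , p | b′ , p′ = proj₁ (unique a b a′ b′ ([]ᵇ>0⇒ p) ([]ᵇ>0⇒ p′))

count≡∑ : ∀ (P : A → Bool) xs → count P xs ≡ ∑ xs (λ x → [ P x ]ᵇ)
count≡∑ P []       = refl
count≡∑ P (x ∷ xs) with P x
... | true  = cong suc (count≡∑ P xs)
... | false = count≡∑ P xs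

count-cong : ∀ (xs : List A) → (∀ x → P x ≡ Q x) → count P xs ≡ count Q xs
count-cong {P = P} {Q} xs P≗Q = begin
  count P xs               ≡⟨ count≡∑ P xs ⟩
  ∑ xs (λ x → [ P x ]ᵇ)    ≡⟨ ∑-cong xs (cong [_]ᵇ ∘ P≗Q) ⟩
  ∑ xs (λ x → [ Q x ]ᵇ)    ≡⟨ count≡∑ Q xs ⟨
  count Q xs               ∎
  where open ≡-Reasoning

count-mono : ∀ (xs : List A) → (∀ x → P x ≡ true → Q x ≡ true) → count P xs ≤ count Q xs
count-mono {P = P} {Q} xs P⇒Q = begin
  count P xs               ≡⟨ count≡∑ P xs ⟩
  ∑ xs (λ x → [ P x ]ᵇ)    ≤⟨ ∑-mono xs ([]ᵇ-mono ∘ P⇒Q) ⟩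
  ∑ xs (λ x → [ Q x ]ᵇ)    ≡⟨ count≡∑ Q xs ⟨
  count Q xs               ∎
  where open ≤-Reasoning

count-false : ∀ (xs : List A) → count (λ _ → false) xs ≡ 0
count-false []       = refl
count-false (x ∷ xs) = count-false xs

count-true : ∀ n → count (λ _ → true) (allFin n) ≡ n
count-true n = trans (go (allFin n)) (length-tabulate (λ i → i))
  where
  go : ∀ (xs : List (Fin n)) → count (λ _ → true) xs ≡ length xs
  go []       = refl
  go (x ∷ xs) = cong suc (go xs)

count-∧ˡ : ∀ b (P : A → Bool) xs → count (λ x → b ∧ P x) xs ≡ [ b ]ᵇ * count P xs
count-∧ˡ true  P xs = sym (*-identityˡ (count P xs))
count-∧ˡ false P xs = count-false xs

count-split : ∀ (P Q : A → Bool) xs →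
              count P xs ≡ count (λ x → P x ∧ Q x) xs + count (λ x → P x ∧ not (Q x)) xs
count-split P Q xs = begin
  count P xs
    ≡⟨ count≡∑ P xs ⟩
  ∑ xs (λ x → [ P x ]ᵇ)
    ≡⟨ ∑-cong xs (λ x → []ᵇ-split (P x) (Q x)) ⟩
  ∑ xs (λ x → [ P x ∧ Q x ]ᵇ + [ P x ∧ not (Q x) ]ᵇ)
    ≡⟨ ∑-+ xs _ _ ⟩
  ∑ xs (λ x → [ P x ∧ Q x ]ᵇ) + ∑ xs (λ x → [ P x ∧ not (Q x) ]ᵇ)
    ≡⟨ cong₂ _+_ (count≡∑ _ xs) (count≡∑ _ xs) ⟨
  count (λ x → P x ∧ Q x) xs + count (λ x → P x ∧ not (Q x)) xs  ∎
  where open ≡-Reasoning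

count-map : ∀ (P : A → Bool) (g : B → A) xs → count P (map g xs) ≡ count (P ∘ g) xs
count-map P g xs = trans (count≡∑ P (map g xs)) (trans (∑-map xs g _) (sym (count≡∑ (P ∘ g) xs)))

count-concatMap : ∀ (P : A → Bool) (g : B → List A) xs →
                  count P (concatMap g xs) ≡ ∑ xs (λ x → count P (g x))
count-concatMap P g xs = begin
  count P (concatMap g xs)               ≡⟨ count≡∑ P (concatMap g xs) ⟩
  ∑ (concatMap g xs) (λ a → [ P a ]ᵇ)    ≡⟨ ∑-concatMap xs g _ ⟩
  ∑ xs (λ x → ∑ (g x) (λ a → [ P a ]ᵇ))  ≡⟨ ∑-cong xs (λ x → count≡∑ P (g x)) ⟨
  ∑ xs (λ x → count P (g x))             ∎
  where open ≡-Reasoning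

count-allFin-suc : ∀ (P : Fin (suc n) → Bool) →
                   count P (allFin (suc n)) ≡ [ P zero ]ᵇ + count (P ∘ suc) (allFin n)
count-allFin-suc {n} P = begin
  count P (allFin (suc n))                   ≡⟨ count≡∑ P (allFin (suc n)) ⟩
  Σv (suc n) (λ i → [ P i ]ᵇ)                ≡⟨ Σv-suc (λ i → [ P i ]ᵇ) ⟩
  [ P zero ]ᵇ + Σv n (λ i → [ P (suc i) ]ᵇ)  ≡⟨ cong ([ P zero ]ᵇ +_) (count≡∑ (P ∘ suc) (allFin n)) ⟨
  [ P zero ]ᵇ + count (P ∘ suc) (allFin n)   ∎
  where open ≡-Reasoning

count-fibres : ∀ (f : A → Fin n) (P : A → Bool) xs →
               Σv n (λ y → count (λ a → (y == f a) ∧ P a) xs) ≡ count P xs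
count-fibres {n = n} f P xs = begin
  Σv n (λ y → count (λ a → (y == f a) ∧ P a) xs)  ≡⟨ ∑-cong (allFin n) (λ y → count≡∑ _ xs) ⟩
  Σv n (λ y → ∑ xs (λ a → [ (y == f a) ∧ P a ]ᵇ)) ≡⟨ ∑-swap (allFin n) xs _ ⟩
  ∑ xs (λ a → Σv n (λ y → [ (y == f a) ∧ P a ]ᵇ)) ≡⟨ ∑-cong xs (λ a → Σv-delta (f a) (λ _ → P a)) ⟩
  ∑ xs (λ a → [ P a ]ᵇ)                           ≡⟨ count≡∑ P xs ⟨
  count P xs                                      ∎
  where open ≡-Reasoning

count-== : ∀ (x : Fin n) → count (_== x) (allFin n) ≡ 1
count-== x = trans (count≡∑ (_== x) (allFin _))
                   (trans (Σv-single x λ y y≢x → cong [_]ᵇ (==-≢ y≢x)) (cong [_]ᵇ (==-refl x)))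

count-remove : ∀ (P : Fin n → Bool) {x} → P x ≡ true →
               count (λ i → P i ∧ not (i == x)) (allFin n) ≡ count P (allFin n) ∸ 1
count-remove {n} P {x} Px = begin
  #rest                                                  ≡⟨ m+n∸m≡n 1 #rest ⟨
  1 + #rest ∸ 1                                          ≡⟨ cong (λ c → c + #rest ∸ 1) #at-x ⟨
  count (λ i → P i ∧ (i == x)) (allFin n) + #rest ∸ 1    ≡⟨ cong (_∸ 1) (count-split P (_== x) (allFin n)) ⟨
  count P (allFin n) ∸ 1                                 ∎
  where
  open ≡-Reasoning
  #rest : ℕ
  #rest = count (λ i → P i ∧ not (i == x)) (allFin n)
  #at-x : count (λ i → P i ∧ (i == x)) (allFin n) ≡ 1
  #at-x = trans (count-cong (allFin n) at-x) (count-== x)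
    where
    at-x : ∀ i → (P i ∧ (i == x)) ≡ (i == x)
    at-x i with i ≟ x
    ... | yes refl = cong (_∧ true) Px
    ... | no  _    = ∧-zeroʳ (P i)

all-allFin⁻ : ∀ (f : Fin k → Bool) → all f (allFin k) ≡ true → ∀ i → f i ≡ true
all-allFin⁻ {suc k} f h i with ∧-true⁻ {f zero} (trans (sym (cong and (map-allFin-suc f))) h)
all-allFin⁻ {suc k} f h zero    | f0 , _    = f0
all-allFin⁻ {suc k} f h (suc i) | _  , rest = all-allFin⁻ (f ∘ suc) rest i

all-allFin⁺ : ∀ (f : Fin k → Bool) → (∀ i → f i ≡ true) → all f (allFin k) ≡ true
all-allFin⁺ {zero}  f h = refl
all-allFin⁺ {suc k} f h = begin
  all f (allFin (suc k))                ≡⟨ cong and (map-allFin-suc f) ⟩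
  f zero ∧ all (f ∘ suc) (allFin k)     ≡⟨ cong₂ _∧_ (h zero) (all-allFin⁺ (f ∘ suc) (h ∘ suc)) ⟩
  true                                  ∎
  where open ≡-Reasoning

inBox : (Fin k → Fin n → Bool) → Vec (Fin n) k → Bool
inBox {k} B φ = all (λ i → B i (lookup φ i)) (allFin k)

inBox-∷ : ∀ (B : Fin (suc k) → Fin n → Bool) x φ → inBox B (x ∷ φ) ≡ B zero x ∧ inBox (B ∘ suc) φ
inBox-∷ B x φ = cong and (map-allFin-suc (λ i → B i (lookup (x ∷ φ) i)))

count-inBox : ∀ (B : Fin k → Fin n → Bool) →
              count (inBox B) (allMaps k n) ≡ ∏ (allFin k) (λ i → count (B i) (allFin n))
count-inBox {zero}      B = refl
count-inBox {suc k} {n} B = begin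
  count (inBox B) (concatMap (λ x → map (x ∷_) (allMaps k n)) (allFin n))
    ≡⟨ count-concatMap (inBox B) _ (allFin n) ⟩
  Σv n (λ x → count (inBox B) (map (x ∷_) (allMaps k n)))
    ≡⟨ ∑-cong (allFin n) (λ x → trans (count-map (inBox B) (x ∷_) (allMaps k n))
                                      (count-cong (allMaps k n) (inBox-∷ B x))) ⟩
  Σv n (λ x → count (λ φ → B zero x ∧ inBox (B ∘ suc) φ) (allMaps k n))
    ≡⟨ ∑-cong (allFin n) (λ x → count-∧ˡ (B zero x) (inBox (B ∘ suc)) (allMaps k n)) ⟩
  Σv n (λ x → [ B zero x ]ᵇ * count (inBox (B ∘ suc)) (allMaps k n))
    ≡⟨ ∑-*ʳ (allFin n) (count (inBox (B ∘ suc)) (allMaps k n)) (λ x → [ B zero x ]ᵇ) ⟩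
  Σv n (λ x → [ B zero x ]ᵇ) * count (inBox (B ∘ suc)) (allMaps k n)
    ≡⟨ cong₂ _*_ (sym (count≡∑ (B zero) (allFin n))) (count-inBox (B ∘ suc)) ⟩
  count (B zero) (allFin n) * ∏ (allFin k) (λ i → count (B (suc i)) (allFin n))
    ≡⟨ cong product (map-allFin-suc (λ i → count (B i) (allFin n))) ⟨
  ∏ (allFin (suc k)) (λ i → count (B i) (allFin n))  ∎
  where open ≡-Reasoning

IsHom : Graph k → Graph n → Vec (Fin n) k → Set
IsHom F G φ = ∀ u v → adj F u v ≡ true → adj G (lookup φ u) (lookup φ v) ≡ true

isHom-sound : ∀ (F : Graph k) (G : Graph n) φ → isHom F G φ ≡ true → IsHom F G φ
isHom-sound F G φ h u v uv = not∨-elim (all-allFin⁻ _ (all-allFin⁻ _ h u) v) uv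

isHom-complete : ∀ (F : Graph k) (G : Graph n) φ → IsHom F G φ → isHom F G φ ≡ true
isHom-complete F G φ h = all-allFin⁺ _ λ u → all-allFin⁺ _ λ v → not∨-intro (h u v)

isHom-cong : ∀ {F F′ : Graph k} (G : Graph n) φ →
             (∀ u v → adj F u v ≡ adj F′ u v) → isHom F G φ ≡ isHom F′ G φ
isHom-cong {k} G φ F≗F′ =
  cong and (map-cong (λ u → cong and (map-cong (λ v → cong (λ b → not b ∨ _) (F≗F′ u v)) (allFin k)))
                     (allFin k))

isHom-mono : ∀ (F H : Graph k) (G : Graph n) φ →
             SpanningSubgraph F H → isHom H G φ ≡ true → isHom F G φ ≡ true
isHom-mono F H G φ F⊆H h = isHom-complete F G φ λ u v uv → isHom-sound H G φ h u v (F⊆H u v uv)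

-- Orientations and edge counts

adj⇒≢ : ∀ (F : Graph k) {u v} → adj F u v ≡ true → u ≢ v
adj⇒≢ F {u} uv refl with trans (sym uv) (irrefl F u)
... | ()

Orients : (Fin k → Fin k → Bool) → Graph k → Set
Orients O F = ∀ u v → adj F u v ≡ true → O u v ≡ not (O v u)

orientedEdges : (Fin k → Fin k → Bool) → Graph k → ℕ
orientedEdges {k} O F = Σv k (λ u → Σv k (λ v → [ O u v ∧ adj F u v ]ᵇ))

<ᵇ-orients : ∀ (F : Graph k) → Orients (λ u v → toℕ u <ᵇ toℕ v) F
<ᵇ-orients F u v uv = <ᵇ-asym (adj⇒≢ F uv ∘ toℕ-injective)
  where
  <ᵇ-asym : ∀ {m n} → m ≢ n → (m <ᵇ n) ≡ not (n <ᵇ m)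
  <ᵇ-asym {zero}  {zero}  m≢n = contradiction refl m≢n
  <ᵇ-asym {zero}  {suc n} m≢n = refl
  <ᵇ-asym {suc m} {zero}  m≢n = refl
  <ᵇ-asym {suc m} {suc n} m≢n = <ᵇ-asym (m≢n ∘ cong suc)

degreeSum≡2*orientedEdges : ∀ {O} (F : Graph k) → Orients O F → Σv k (deg F) ≡ 2 * orientedEdges O F
degreeSum≡2*orientedEdges {k} {O} F O-orients = begin
  Σv k (deg F)
    ≡⟨ ∑-cong (allFin k) (λ u → count≡∑ (adj F u) (allFin k)) ⟩
  Σv k (λ u → Σv k (λ v → [ adj F u v ]ᵇ))
    ≡⟨ ∑-cong (allFin k) (λ u → ∑-cong (allFin k) (λ v → split (O-orients u v))) ⟩
  Σv k (λ u → Σv k (λ v → [ O u v ∧ adj F u v ]ᵇ + [ O v u ∧ adj F u v ]ᵇ))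
    ≡⟨ trans (∑-cong (allFin k) (λ u → ∑-+ (allFin k) _ _)) (∑-+ (allFin k) _ _) ⟩
  orientedEdges O F + Σv k (λ u → Σv k (λ v → [ O v u ∧ adj F u v ]ᵇ))
    ≡⟨ cong (orientedEdges O F +_) (∑-swap (allFin k) (allFin k) _) ⟩
  orientedEdges O F + Σv k (λ v → Σv k (λ u → [ O v u ∧ adj F u v ]ᵇ))
    ≡⟨ cong (orientedEdges O F +_) (∑-cong (allFin k) (λ v → ∑-cong (allFin k) (λ u →
         cong (λ b → [ O v u ∧ b ]ᵇ) (adj-sym F u v)))) ⟩
  orientedEdges O F + orientedEdges O F
    ≡⟨ cong (orientedEdges O F +_) (+-identityʳ (orientedEdges O F)) ⟨
  2 * orientedEdges O F  ∎
  where
  open ≡-Reasoning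
  split : ∀ {a o o′} → (a ≡ true → o ≡ not o′) → [ a ]ᵇ ≡ [ o ∧ a ]ᵇ + [ o′ ∧ a ]ᵇ
  split {false} {o} {o′} _ rewrite ∧-zeroʳ o | ∧-zeroʳ o′ = refl
  split {true}  {o} {true}  o≡¬o′ rewrite o≡¬o′ refl = refl
  split {true}  {o} {false} o≡¬o′ rewrite o≡¬o′ refl = refl

-- edgeCount itself orients edges by toℕ u < toℕ v, and both sides are half the degree sum.
edgeCount≡orientedEdges : ∀ {O} (F : Graph k) → Orients O F → edgeCount F ≡ orientedEdges O F
edgeCount≡orientedEdges F O-orients = *-cancelˡ-≡ _ _ 2
  (trans (sym (degreeSum≡2*orientedEdges F (<ᵇ-orients F))) (degreeSum≡2*orientedEdges F O-orients))

missing : (Fin k → Fin k → Bool) → Graph k → Graph k → Fin k → Fin k → Bool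
missing O H F a b = (O a b ∧ adj H a b) ∧ not (adj F a b)

edgeCount-missing : ∀ {O} {F H : Graph k} → SpanningSubgraph F H → Orients O H →
  edgeCount H ≡ edgeCount F + Σv k (λ a → Σv k (λ b → [ missing O H F a b ]ᵇ))
edgeCount-missing {k} {O} {F} {H} F⊆H O-orients = begin
  edgeCount H
    ≡⟨ edgeCount≡orientedEdges H O-orients ⟩
  Σv k (λ a → Σv k (λ b → [ O a b ∧ adj H a b ]ᵇ))
    ≡⟨ ∑-cong (allFin k) (λ a → ∑-cong (allFin k) (λ b → []ᵇ-split (O a b ∧ adj H a b) (adj F a b))) ⟩
  Σv k (λ a → Σv k (λ b → [ (O a b ∧ adj H a b) ∧ adj F a b ]ᵇ + [ missing O H F a b ]ᵇ))
    ≡⟨ trans (∑-cong (allFin k) (λ a → ∑-+ (allFin k) _ _)) (∑-+ (allFin k) _ _) ⟩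
  Σv k (λ a → Σv k (λ b → [ (O a b ∧ adj H a b) ∧ adj F a b ]ᵇ)) + #missing
    ≡⟨ cong (_+ #missing) (∑-cong (allFin k) λ a → ∑-cong (allFin k) λ b → cong [_]ᵇ (drop-H (F⊆H a b))) ⟩
  orientedEdges O F + #missing
    ≡⟨ cong (_+ #missing) (edgeCount≡orientedEdges F (λ u v uv → O-orients u v (F⊆H u v uv))) ⟨
  edgeCount F + #missing  ∎
  where
  open ≡-Reasoning
  #missing : ℕ
  #missing = Σv k (λ a → Σv k (λ b → [ missing O H F a b ]ᵇ))
  drop-H : ∀ {o h f} → (f ≡ true → h ≡ true) → (o ∧ h) ∧ f ≡ o ∧ f
  drop-H {o} {h} {false} _   rewrite ∧-zeroʳ (o ∧ h) | ∧-zeroʳ o = refl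
  drop-H {o} {h} {true}  f⇒h rewrite f⇒h refl = ∧-identityʳ (o ∧ true)

-- Stars

IsStar : Graph k → Fin k → Set
IsStar F c = ∀ u v → adj F u v ≡ true → u ≡ c ⊎ v ≡ c

edgeCount-star : ∀ (F : Graph k) {c} → IsStar F c → edgeCount F ≡ deg F c
edgeCount-star {k} F {c} star = begin
  edgeCount F
    ≡⟨ edgeCount≡orientedEdges F centre-orients ⟩
  Σv k (λ u → Σv k (λ v → [ (u == c) ∧ adj F u v ]ᵇ))
    ≡⟨ ∑-swap (allFin k) (allFin k) _ ⟩
  Σv k (λ v → Σv k (λ u → [ (u == c) ∧ adj F u v ]ᵇ))
    ≡⟨ ∑-cong (allFin k) (λ v → Σv-delta c (λ u → adj F u v)) ⟩
  Σv k (λ v → [ adj F c v ]ᵇ)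
    ≡⟨ count≡∑ (adj F c) (allFin k) ⟨
  deg F c  ∎
  where
  open ≡-Reasoning
  centre-orients : Orients (λ u _ → u == c) F
  centre-orients u v uv with star u v uv
  ... | inj₁ refl = trans (==-refl u) (sym (cong not (==-≢ (adj⇒≢ F uv ∘ sym))))
  ... | inj₂ refl = trans (==-≢ (adj⇒≢ F uv)) (sym (cong not (==-refl v)))

module _ (F : Graph k) (G : Graph n) {c : Fin k} (star : IsStar F c) where

  starBox : Fin n → Fin k → Fin n → Bool
  starBox x i t = if i == c then t == x else not (adj F c i) ∨ adj G x t

  starBox-centre : ∀ x t → starBox x c t ≡ (t == x)
  starBox-centre x t = cong (if_then t == x else _) (==-refl c)

  starBox-leaf : ∀ x {i} t → i ≢ c → starBox x i t ≡ (not (adj F c i) ∨ adj G x t)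
  starBox-leaf x t i≢c = cong (if_then t == x else _) (==-≢ i≢c)

  inBox-starBox : ∀ x φ → inBox (starBox x) φ ≡ (x == lookup φ c) ∧ isHom F G φ
  inBox-starBox x φ = ≡true-ext to from
    where
    to : inBox (starBox x) φ ≡ true → ((x == lookup φ c) ∧ isHom F G φ) ≡ true
    to h = trans (cong₂ _∧_ (cong (x ==_) (sym x≡φc)) (isHom-complete F G φ preserves))
                 (cong (_∧ true) (==-refl x))
      where
      cell : ∀ i → starBox x i (lookup φ i) ≡ true
      cell = all-allFin⁻ _ h
      x≡φc : x ≡ lookup φ c
      x≡φc = sym (==⇒≡ (trans (sym (starBox-centre x (lookup φ c))) (cell c)))
      leaf : ∀ i → adj F c i ≡ true → adj G (lookup φ c) (lookup φ i) ≡ true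
      leaf i ci = subst (λ y → adj G y (lookup φ i) ≡ true) x≡φc
                    (not∨-elim (trans (sym (starBox-leaf x _ (adj⇒≢ F ci ∘ sym))) (cell i)) ci)
      preserves : IsHom F G φ
      preserves u v uv with star u v uv
      ... | inj₁ refl = leaf v uv
      ... | inj₂ refl = trans (adj-sym G _ _) (leaf u (trans (adj-sym F v u) uv))
    from : ((x == lookup φ c) ∧ isHom F G φ) ≡ true → inBox (starBox x) φ ≡ true
    from h with ∧-true⁻ {x == lookup φ c} h
    ... | x==φc , φ-hom = all-allFin⁺ _ cell
      where
      x≡φc : x ≡ lookup φ c
      x≡φc = ==⇒≡ x==φc
      cell : ∀ i → starBox x i (lookup φ i) ≡ true
      cell i with i ≟ c
      ... | yes refl = trans (cong (_== x) (sym x≡φc)) (==-refl x)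
      ... | no  i≢c  = not∨-intro λ ci → subst (λ y → adj G y (lookup φ i) ≡ true) (sym x≡φc)
                                            (isHom-sound F G φ φ-hom c i ci)

  count-starBox : ∀ x i → count (starBox x i) (allFin n) ≡
    (if adj F c i then deg G x else 1) * (if not (i == c) ∧ not (adj F c i) then n else 1)
  count-starBox x i with i ≟ c
  ... | yes refl rewrite irrefl F c = count-== x
  ... | no  _    with adj F c i
  ...   | true  = sym (*-identityʳ (deg G x))
  ...   | false = trans (count-true n) (sym (*-identityˡ n))

  isolated : ℕ
  isolated = count (λ i → not (i == c) ∧ not (adj F c i)) (allFin k)

  isolated≡ : isolated ≡ k ∸ 1 ∸ deg F c
  isolated≡ = begin
    isolated
      ≡⟨ m+n∸m≡n (deg F c) isolated ⟨
    deg F c + isolated ∸ deg F c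
      ≡⟨ cong (λ d → d + isolated ∸ deg F c) leaves ⟨
    count (λ i → not (i == c) ∧ adj F c i) (allFin k) + isolated ∸ deg F c
      ≡⟨ cong (_∸ deg F c) (count-split (λ i → not (i == c)) (adj F c) (allFin k)) ⟨
    count (λ i → not (i == c)) (allFin k) ∸ deg F c
      ≡⟨ cong (_∸ deg F c) (count-remove (λ _ → true) {c} refl) ⟩
    count (λ _ → true) (allFin k) ∸ 1 ∸ deg F c
      ≡⟨ cong (λ m → m ∸ 1 ∸ deg F c) (count-true k) ⟩
    k ∸ 1 ∸ deg F c  ∎
    where
    open ≡-Reasoning
    leaves : count (λ i → not (i == c) ∧ adj F c i) (allFin k) ≡ deg F c
    leaves = count-cong (allFin k) λ i → ≡true-ext (proj₂ ∘ ∧-true⁻)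
               λ ci → trans (cong (λ b → not b ∧ adj F c i) (==-≢ (adj⇒≢ F ci ∘ sym))) ci

  hom-star-deg : hom F G ≡ n ^ (k ∸ 1 ∸ deg F c) * Σv n (λ x → deg G x ^ deg F c)
  hom-star-deg = begin
    hom F G
      ≡⟨ count-fibres (λ φ → lookup φ c) (isHom F G) (allMaps k n) ⟨
    Σv n (λ x → count (λ φ → (x == lookup φ c) ∧ isHom F G φ) (allMaps k n))
      ≡⟨ ∑-cong (allFin n) (λ x → count-cong (allMaps k n) (inBox-starBox x)) ⟨
    Σv n (λ x → count (inBox (starBox x)) (allMaps k n))
      ≡⟨ ∑-cong (allFin n) (λ x → trans (count-inBox (starBox x))
                                        (cong product (map-cong (count-starBox x) (allFin k)))) ⟩
    Σv n (λ x → ∏ (allFin k) (λ i → (if adj F c i then deg G x else 1)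
                                   * (if not (i == c) ∧ not (adj F c i) then n else 1)))
      ≡⟨ ∑-cong (allFin n) (λ x → trans (∏-* (allFin k) _ _)
           (cong₂ _*_ (∏-if-^ (allFin k) (adj F c) (deg G x)) (∏-if-^ (allFin k) _ n))) ⟩
    Σv n (λ x → deg G x ^ deg F c * n ^ isolated)
      ≡⟨ trans (∑-*ʳ (allFin n) _ _) (*-comm _ (n ^ isolated)) ⟩
    n ^ isolated * Σv n (λ x → deg G x ^ deg F c)
      ≡⟨ cong (λ m → n ^ m * Σv n (λ x → deg G x ^ deg F c)) isolated≡ ⟩
    n ^ (k ∸ 1 ∸ deg F c) * Σv n (λ x → deg G x ^ deg F c)  ∎
    where open ≡-Reasoning

hom-star : ∀ (F : Graph k) (G : Graph n) {c} → IsStar F c →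
  hom F G ≡ n ^ (k ∸ 1 ∸ edgeCount F) * Σv n (λ x → deg G x ^ edgeCount F)
hom-star F G star rewrite edgeCount-star F star = hom-star-deg F G star

-- Maps breaking exactly one edge

SameEdge : Fin k → Fin k → Fin k → Fin k → Set
SameEdge a b i j = (i ≡ a × j ≡ b) ⊎ (i ≡ b × j ≡ a)

sameEdge? : ∀ (a b i j : Fin k) → Dec (SameEdge a b i j)
sameEdge? a b i j = (i ≟ a ×-dec j ≟ b) ⊎-dec (i ≟ b ×-dec j ≟ a)

deleteEdge : Graph k → Fin k → Fin k → Graph k
deleteEdge H a b = record
  { adj    = λ i j → adj H i j ∧ not (does (sameEdge? a b i j))
  ; sym    = λ i j → cong₂ (λ e s → e ∧ not s) (adj-sym H i j)
                             (does-⇔ (mk⇔ flip flip) (sameEdge? a b i j) (sameEdge? a b j i))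
  ; irrefl = λ i → cong (_∧ _) (irrefl H i)
  }
  where
  flip : ∀ {i j} → SameEdge a b i j → SameEdge a b j i
  flip = Sum.swap ∘ Sum.map Product.swap Product.swap

deleteEdge-keeps : ∀ (H : Graph k) {a b i j} →
                   adj H i j ≡ true → ¬ SameEdge a b i j → adj (deleteEdge H a b) i j ≡ true
deleteEdge-keeps H {a} {b} {i} {j} ij ¬same =
  cong₂ (λ e s → e ∧ not s) ij (dec-false (sameEdge? a b i j) ¬same)

deleteEdge-sound : ∀ (H : Graph k) {a b i j} →
                   adj (deleteEdge H a b) i j ≡ true → adj H i j ≡ true × ¬ SameEdge a b i j
deleteEdge-sound H {a} {b} {i} {j} h with ∧-true⁻ {adj H i j} h
... | ij , kept = ij , λ same →
  contradiction (trans (sym (dec-true (sameEdge? a b i j) same)) (not-true⁻ kept)) λ ()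

breaksOnly : Graph k → Graph n → Fin k → Fin k → Vec (Fin n) k → Bool
breaksOnly H G a b φ = not (adj G (lookup φ a) (lookup φ b)) ∧ isHom (deleteEdge H a b) G φ

breaksOnly-sym : ∀ (H : Graph k) (G : Graph n) a b φ → breaksOnly H G a b φ ≡ breaksOnly H G b a φ
breaksOnly-sym H G a b φ = cong₂ _∧_ (cong not (adj-sym G (lookup φ a) (lookup φ b)))
  (isHom-cong {F = deleteEdge H a b} {deleteEdge H b a} G φ λ i j →
     cong (λ s → adj H i j ∧ not s) (does-⇔ (mk⇔ Sum.swap Sum.swap) (sameEdge? a b i j) (sameEdge? b a i j)))

breaksOnly-sound : ∀ (H : Graph k) (G : Graph n) a b φ → breaksOnly H G a b φ ≡ true →
  ∀ i j → adj H i j ≡ true → adj G (lookup φ i) (lookup φ j) ≡ false → SameEdge a b i j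
breaksOnly-sound H G a b φ h i j ij φij with sameEdge? a b i j
... | yes same = same
... | no  ¬same = contradiction (trans (sym φij-edge) φij) λ ()
  where
  φ-hom : isHom (deleteEdge H a b) G φ ≡ true
  φ-hom = proj₂ (∧-true⁻ {not (adj G (lookup φ a) (lookup φ b))} h)
  φij-edge : adj G (lookup φ i) (lookup φ j) ≡ true
  φij-edge = isHom-sound (deleteEdge H a b) G φ φ-hom i j (deleteEdge-keeps H ij ¬same)

module _ {F H : Graph k} (G : Graph n) (F⊆H : SpanningSubgraph F H) {O} (O-orients : Orients O H) where

  private
    maps : List (Vec (Fin n) k)
    maps = allMaps k n

    broken : Fin k → Fin k → Vec (Fin n) k → Bool
    broken a b φ = missing O H F a b ∧ breaksOnly H G a b φ

    module Broken (a b : Fin k) (φ : Vec (Fin n) k) (h : broken a b φ ≡ true) where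
      missing-ab : missing O H F a b ≡ true
      missing-ab = proj₁ (∧-true⁻ h)
      breaks : breaksOnly H G a b φ ≡ true
      breaks = proj₂ (∧-true⁻ {missing O H F a b} h)
      O-ab : O a b ≡ true
      O-ab = proj₁ (∧-true⁻ (proj₁ (∧-true⁻ missing-ab)))
      H-ab : adj H a b ≡ true
      H-ab = proj₂ (∧-true⁻ {O a b} (proj₁ (∧-true⁻ missing-ab)))
      F-ab : adj F a b ≡ false
      F-ab = not-true⁻ (proj₂ (∧-true⁻ {O a b ∧ adj H a b} missing-ab))
      G-ab : adj G (lookup φ a) (lookup φ b) ≡ false
      G-ab = not-true⁻ (proj₁ (∧-true⁻ breaks))
      φ-hom : isHom (deleteEdge H a b) G φ ≡ true
      φ-hom = proj₂ (∧-true⁻ {not (adj G (lookup φ a) (lookup φ b))} breaks)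

    broken⇒isHom : ∀ a b φ → broken a b φ ≡ true → isHom F G φ ≡ true
    broken⇒isHom a b φ h = isHom-mono F (deleteEdge H a b) G φ F⊆H−ab φ-hom
      where
      open Broken a b φ h
      F⊆H−ab : SpanningSubgraph F (deleteEdge H a b)
      F⊆H−ab i j ij with sameEdge? a b i j
      ... | yes (inj₁ (refl , refl)) = contradiction (trans (sym ij) F-ab) λ ()
      ... | yes (inj₂ (refl , refl)) = contradiction (trans (sym ij) (trans (adj-sym F b a) F-ab)) λ ()
      ... | no  ¬same                = deleteEdge-keeps H (F⊆H i j ij) ¬same

    broken-unique : ∀ a b a′ b′ φ → broken a b φ ≡ true → broken a′ b′ φ ≡ true →
                    a ≡ a′ × b ≡ b′
    broken-unique a b a′ b′ φ h h′ = same-orientation (breaksOnly-sound H G a b φ ab.breaks a′ b′ a′b′.H-ab a′b′.G-ab)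
      where
      module ab   = Broken a b φ h
      module a′b′ = Broken a′ b′ φ h′
      same-orientation : SameEdge a b a′ b′ → a ≡ a′ × b ≡ b′
      same-orientation (inj₁ (a′≡a , b′≡b)) = sym a′≡a , sym b′≡b
      same-orientation (inj₂ (a′≡b , b′≡a)) =
        contradiction (trans (sym ab.O-ab) (trans (O-orients a b ab.H-ab) (cong not O-ba))) λ ()
        where
        O-ba : O b a ≡ true
        O-ba = subst₂ (λ s t → O s t ≡ true) a′≡b b′≡a a′b′.O-ab

    pointwise : ∀ φ →
      [ isHom H G φ ]ᵇ + Σv k (λ a → Σv k (λ b → [ broken a b φ ]ᵇ)) ≤ [ isHom F G φ ]ᵇ
    pointwise φ with isHom H G φ in H-hom
    ... | false = Σv²-[]ᵇ-≤ (λ a b → broken a b φ) (λ a b → broken⇒isHom a b φ)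
                            (λ a b a′ b′ → broken-unique a b a′ b′ φ)
    ... | true rewrite isHom-mono F H G φ F⊆H H-hom =
      s≤s (≤-reflexive (∑-zero (allFin k) λ a → ∑-zero (allFin k) (none a)))
      where
      none : ∀ a b → [ broken a b φ ]ᵇ ≡ 0
      none a b with broken a b φ in h
      ... | false = refl
      ... | true  = contradiction (trans (sym (isHom-sound H G φ H-hom a b ab.H-ab)) ab.G-ab) λ ()
        where module ab = Broken a b φ h

  hom-subgraph-lower-bound :
    hom H G + Σv k (λ a → Σv k (λ b → [ missing O H F a b ]ᵇ * count (breaksOnly H G a b) maps)) ≤ hom F G
  hom-subgraph-lower-bound = begin
    hom H G + Σv k (λ a → Σv k (λ b → [ missing O H F a b ]ᵇ * count (breaksOnly H G a b) maps))
      ≡⟨ cong₂ _+_ (count≡∑ (isHom H G) maps) (∑-cong (allFin k) λ a → ∑-cong (allFin k) λ b →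
           trans (sym (count-∧ˡ (missing O H F a b) (breaksOnly H G a b) maps)) (count≡∑ (broken a b) maps)) ⟩
    ∑ maps (λ φ → [ isHom H G φ ]ᵇ) + Σv k (λ a → Σv k (λ b → ∑ maps (λ φ → [ broken a b φ ]ᵇ)))
      ≡⟨ cong (∑ maps (λ φ → [ isHom H G φ ]ᵇ) +_)
              (trans (∑-cong (allFin k) (λ a → ∑-swap (allFin k) maps _)) (∑-swap (allFin k) maps _)) ⟩
    ∑ maps (λ φ → [ isHom H G φ ]ᵇ) + ∑ maps (λ φ → Σv k (λ a → Σv k (λ b → [ broken a b φ ]ᵇ)))
      ≡⟨ ∑-+ maps _ _ ⟨
    ∑ maps (λ φ → [ isHom H G φ ]ᵇ + Σv k (λ a → Σv k (λ b → [ broken a b φ ]ᵇ)))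
      ≤⟨ ∑-mono maps pointwise ⟩
    ∑ maps (λ φ → [ isHom F G φ ]ᵇ)
      ≡⟨ count≡∑ (isHom F G) maps ⟨
    hom F G  ∎
    where open ≤-Reasoning

ηUnrestricted : ℕ → Graph n → ℕ
ηUnrestricted {n} r G =
  Σv n (λ u → Σv n (λ v → Σv n (λ w → [ not (adj G u v) ∧ adj G u w ]ᵇ * commonNbrs G v w ^ r)))

η≤ηUnrestricted : ∀ p q (G : Graph n) → η p q G ≤ ηUnrestricted (p ⊔ q ∸ 1) G
η≤ηUnrestricted {n} p q G = ∑-mono (allFin n) λ u → ∑-mono (allFin n) λ v → term u v
  where
  r : ℕ
  r = p ⊔ q ∸ 1
  summand : ∀ {c} a b m → c ≡ true → (if a ∧ b then m else 0) ≤ [ c ∧ a ]ᵇ * m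
  summand true  true  m refl = ≤-reflexive (sym (*-identityˡ m))
  summand true  false m _    = z≤n
  summand false b     m _    = z≤n
  term : ∀ u v →
    (if inD G u v then Σv n (λ w → if adj G u w ∧ (0 <ᵇ commonNbrs G v w) then commonNbrs G v w ^ r else 0) else 0)
    ≤ Σv n (λ w → [ not (adj G u v) ∧ adj G u w ]ᵇ * commonNbrs G v w ^ r)
  term u v with inD G u v in uv∈D
  ... | false = z≤n
  ... | true  = ∑-mono (allFin n) λ w →
    summand (adj G u w) (0 <ᵇ commonNbrs G v w) (commonNbrs G v w ^ r) (proj₁ (∧-true⁻ {not (adj G u v)} uv∈D))

module _ (G : Graph n) {H : Graph k} (side : Fin k → Bool)
         (bipartite : ∀ i j → adj H i j ≡ true → side i ≡ not (side j))
         {x y y′ : Fin k} (x-in : side x ≡ true) (y-out : side y ≡ false)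
         (y′-out : side y′ ≡ false) (y′≢y : y′ ≢ y) where

  private
    across : ∀ {i j} → side i ≡ true → side j ≡ false → i ≢ j
    across si sj refl = contradiction (trans (sym si) sj) λ ()

    maps : List (Vec (Fin n) k)
    maps = allMaps k n

  patternBox : Fin n → Fin n → Fin n → Fin k → Fin n → Bool
  patternBox u v w i t =
    if i == x then t == u else if i == y then t == v else if side i then adj G v t ∧ adj G w t else t == w

  patternBox-x : ∀ u v w t → patternBox u v w x t ≡ (t == u)
  patternBox-x u v w t rewrite ==-refl x = refl

  patternBox-y : ∀ u v w t → patternBox u v w y t ≡ (t == v)
  patternBox-y u v w t rewrite ==-≢ (across x-in y-out ∘ sym) | ==-refl y = refl

  patternBox-in : ∀ u v w t {i} → side i ≡ true → i ≢ x → patternBox u v w i t ≡ (adj G v t ∧ adj G w t)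
  patternBox-in u v w t si i≢x rewrite ==-≢ i≢x | ==-≢ (across si y-out) | si = refl

  patternBox-out : ∀ u v w t {j} → side j ≡ false → j ≢ y → patternBox u v w j t ≡ (t == w)
  patternBox-out u v w t sj j≢y rewrite ==-≢ (across x-in sj ∘ sym) | ==-≢ j≢y | sj = refl

  count-patternBox : ∀ u v w i →
    count (patternBox u v w i) (allFin n) ≡ (if side i ∧ not (i == x) then commonNbrs G v w else 1)
  count-patternBox u v w i with i ≟ x
  ... | yes refl rewrite x-in = count-== u
  ... | no  _    with i ≟ y
  ...   | yes refl rewrite y-out = count-== v
  ...   | no  _    with side i
  ...     | true  = refl
  ...     | false = count-== w

  count-inBox-patternBox : ∀ u v w →
    count (inBox (patternBox u v w)) maps ≡ commonNbrs G v w ^ (count side (allFin k) ∸ 1)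
  count-inBox-patternBox u v w = begin
    count (inBox (patternBox u v w)) maps
      ≡⟨ count-inBox (patternBox u v w) ⟩
    ∏ (allFin k) (λ i → count (patternBox u v w i) (allFin n))
      ≡⟨ cong product (map-cong (count-patternBox u v w) (allFin k)) ⟩
    ∏ (allFin k) (λ i → if side i ∧ not (i == x) then commonNbrs G v w else 1)
      ≡⟨ ∏-if-^ (allFin k) _ (commonNbrs G v w) ⟩
    commonNbrs G v w ^ count (λ i → side i ∧ not (i == x)) (allFin k)
      ≡⟨ cong (commonNbrs G v w ^_) (count-remove side x-in) ⟩
    commonNbrs G v w ^ (count side (allFin k) ∸ 1)  ∎
    where open ≡-Reasoning

  module InPatternBox (u v w : Fin n) (φ : Vec (Fin n) k) (h : inBox (patternBox u v w) φ ≡ true) where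

    private
      cell : ∀ i → patternBox u v w i (lookup φ i) ≡ true
      cell = all-allFin⁻ _ h

    φx : lookup φ x ≡ u
    φx = ==⇒≡ (trans (sym (patternBox-x u v w _)) (cell x))

    φy : lookup φ y ≡ v
    φy = ==⇒≡ (trans (sym (patternBox-y u v w _)) (cell y))

    φ-in : ∀ {i} → side i ≡ true → i ≢ x → (adj G v (lookup φ i) ∧ adj G w (lookup φ i)) ≡ true
    φ-in {i} si i≢x = trans (sym (patternBox-in u v w _ si i≢x)) (cell i)

    φ-out : ∀ {j} → side j ≡ false → j ≢ y → lookup φ j ≡ w
    φ-out {j} sj j≢y = ==⇒≡ (trans (sym (patternBox-out u v w _ sj j≢y)) (cell j))

  pattern⇒breaksOnly : ∀ u v w φ →
    ((not (adj G u v) ∧ adj G u w) ∧ inBox (patternBox u v w) φ) ≡ true →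
    ((w == lookup φ y′) ∧ ((v == lookup φ y) ∧ ((u == lookup φ x) ∧ breaksOnly H G x y φ))) ≡ true
  pattern⇒breaksOnly u v w φ h =
    cong₂ _∧_ (≡⇒== (sym (φ-out y′-out y′≢y)))
      (cong₂ _∧_ (≡⇒== (sym φy))
        (cong₂ _∧_ (≡⇒== (sym φx))
          (cong₂ _∧_ (subst₂ (λ a b → not (adj G a b) ≡ true) (sym φx) (sym φy) ¬uv)
                     (isHom-complete (deleteEdge H x y) G φ preserved))))
    where
    ¬uv : not (adj G u v) ≡ true
    ¬uv = proj₁ (∧-true⁻ (proj₁ (∧-true⁻ h)))
    uw : adj G u w ≡ true
    uw = proj₂ (∧-true⁻ {not (adj G u v)} (proj₁ (∧-true⁻ h)))
    open InPatternBox u v w φ (proj₂ (∧-true⁻ {not (adj G u v) ∧ adj G u w} h))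

    cross : ∀ {i j} → side i ≡ true → side j ≡ false → ¬ (i ≡ x × j ≡ y) →
            adj G (lookup φ i) (lookup φ j) ≡ true
    cross {i} {j} si sj ¬xy with i ≟ x
    ... | yes refl = subst₂ (λ a b → adj G a b ≡ true) (sym φx) (sym (φ-out sj λ j≡y → ¬xy (refl , j≡y))) uw
    ... | no  i≢x  with j ≟ y | ∧-true⁻ (φ-in si i≢x)
    ...   | yes refl | vi , _ =
      subst (λ b → adj G (lookup φ i) b ≡ true) (sym φy) (trans (adj-sym G _ _) vi)
    ...   | no  j≢y  | _ , wi =
      subst (λ b → adj G (lookup φ i) b ≡ true) (sym (φ-out sj j≢y)) (trans (adj-sym G _ _) wi)

    preserved : IsHom (deleteEdge H x y) G φ
    preserved i j ij with deleteEdge-sound H ij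
    ... | Hij , ¬same with side j in sj
    ...   | false = cross (trans (bipartite i j Hij) (cong not sj)) sj (¬same ∘ inj₁)
    ...   | true  = trans (adj-sym G _ _)
                          (cross sj (trans (bipartite i j Hij) (cong not sj)) (¬same ∘ inj₂ ∘ Product.swap))

  ηUnrestricted≤count-breaksOnly : ηUnrestricted (count side (allFin k) ∸ 1) G ≤ count (breaksOnly H G x y) maps
  ηUnrestricted≤count-breaksOnly = begin
    Σv n (λ u → Σv n (λ v → Σv n (λ w → [ uvw u v w ]ᵇ * commonNbrs G v w ^ r)))
      ≡⟨ ∑-cong (allFin n) (λ u → ∑-cong (allFin n) λ v → ∑-cong (allFin n) λ w →
           trans (cong ([ uvw u v w ]ᵇ *_) (sym (count-inBox-patternBox u v w)))
                 (sym (count-∧ˡ (uvw u v w) (inBox (patternBox u v w)) maps))) ⟩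
    Σv n (λ u → Σv n (λ v → Σv n (λ w → count (λ φ → uvw u v w ∧ inBox (patternBox u v w) φ) maps)))
      ≤⟨ ∑-mono (allFin n) (λ u → ∑-mono (allFin n) λ v → ∑-mono (allFin n) λ w →
           count-mono maps (pattern⇒breaksOnly u v w)) ⟩
    Σv n (λ u → Σv n (λ v → Σv n (λ w → count (λ φ → (w == lookup φ y′) ∧ fibre-xy u v φ) maps)))
      ≡⟨ ∑-cong (allFin n) (λ u → ∑-cong (allFin n) λ v → count-fibres (λ φ → lookup φ y′) _ maps) ⟩
    Σv n (λ u → Σv n (λ v → count (fibre-xy u v) maps))
      ≡⟨ ∑-cong (allFin n) (λ u → count-fibres (λ φ → lookup φ y) _ maps) ⟩
    Σv n (λ u → count (λ φ → (u == lookup φ x) ∧ breaksOnly H G x y φ) maps)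
      ≡⟨ count-fibres (λ φ → lookup φ x) _ maps ⟩
    count (breaksOnly H G x y) maps  ∎
    where
    open ≤-Reasoning
    r : ℕ
    r = count side (allFin k) ∸ 1
    uvw : Fin n → Fin n → Fin n → Bool
    uvw u v w = not (adj G u v) ∧ adj G u w
    fibre-xy : Fin n → Fin n → Vec (Fin n) k → Bool
    fibre-xy u v φ = (v == lookup φ y) ∧ ((u == lookup φ x) ∧ breaksOnly H G x y φ)

-- Complete bipartite graphs

left : ℕ → Fin k → Bool
left p i = toℕ i <ᵇ p

leftToRight : ℕ → Fin k → Fin k → Bool
leftToRight p a b = left p a ∧ not (left p b)

leftToRight-orients : ∀ p q → Orients (leftToRight p) (K p q)
leftToRight-orients p q a b ab = orient (left p a) (left p b) ab
  where
  orient : ∀ α β → α xor β ≡ true → (α ∧ not β) ≡ not (β ∧ not α)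
  orient true  false _ = refl
  orient false true  _ = refl

count-left : ∀ p q → count (left p) (allFin (p + q)) ≡ p
count-left zero    q = count-false (allFin q)
count-left (suc p) q = trans (count-allFin-suc {p + q} (left (suc p))) (cong suc (count-left p q))

count-right : ∀ p q → count (not ∘ left p) (allFin (p + q)) ≡ q
count-right p q = +-cancelˡ-≡ p _ _ (begin
  p + #right                                ≡⟨ cong (_+ #right) (count-left p q) ⟨
  count (left p) (allFin (p + q)) + #right  ≡⟨ count-split (λ _ → true) (left p) (allFin (p + q)) ⟨
  count (λ _ → true) (allFin (p + q))       ≡⟨ count-true (p + q) ⟩
  p + q                                     ∎)
  where
  open ≡-Reasoning
  #right : ℕ
  #right = count (not ∘ left p) (allFin (p + q))

edgeCount-K : ∀ p q → edgeCount (K p q) ≡ p * q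
edgeCount-K p q = begin
  edgeCount (K p q)
    ≡⟨ edgeCount≡orientedEdges (K p q) (leftToRight-orients p q) ⟩
  Σv (p + q) (λ a → Σv (p + q) (λ b → [ leftToRight p a b ∧ (left p a xor left p b) ]ᵇ))
    ≡⟨ ∑-cong (allFin (p + q)) (λ a → ∑-cong (allFin (p + q)) λ b → split (left p a) (left p b)) ⟩
  Σv (p + q) (λ a → Σv (p + q) (λ b → [ left p a ]ᵇ * [ not (left p b) ]ᵇ))
    ≡⟨ ∑-cong (allFin (p + q)) (λ a → ∑-*ˡ (allFin (p + q)) [ left p a ]ᵇ _) ⟩
  Σv (p + q) (λ a → [ left p a ]ᵇ * Σv (p + q) (λ b → [ not (left p b) ]ᵇ))
    ≡⟨ ∑-*ʳ (allFin (p + q)) _ _ ⟩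
  Σv (p + q) (λ a → [ left p a ]ᵇ) * Σv (p + q) (λ b → [ not (left p b) ]ᵇ)
    ≡⟨ cong₂ _*_ (count≡∑ (left p) (allFin (p + q))) (count≡∑ (not ∘ left p) (allFin (p + q))) ⟨
  count (left p) (allFin (p + q)) * count (not ∘ left p) (allFin (p + q))
    ≡⟨ cong₂ _*_ (count-left p q) (count-right p q) ⟩
  p * q  ∎
  where
  open ≡-Reasoning
  split : ∀ α β → [ (α ∧ not β) ∧ (α xor β) ]ᵇ ≡ [ α ]ᵇ * [ not β ]ᵇ
  split true  true  = refl
  split true  false = refl
  split false β     = refl

left-↑ʳ : ∀ p {q} (i : Fin q) → left p (p ↑ʳ i) ≡ false
left-↑ʳ zero    i = refl
left-↑ʳ (suc p) i = left-↑ʳ p i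

witness-avoiding : ∀ {P : Fin k → Bool} {β x₁ x₂} → x₁ ≢ x₂ → P x₁ ≡ β → P x₂ ≡ β →
                   ∀ b → ∃ λ b′ → P b′ ≡ β × b′ ≢ b
witness-avoiding {x₁ = x₁} {x₂} x₁≢x₂ P₁ P₂ b with x₁ ≟ b
... | yes refl = x₂ , P₂ , x₁≢x₂ ∘ sym
... | no  x₁≢b = x₁ , P₁ , x₁≢b

η≤count-breaksOnly : ∀ {p q} (G : Graph n) → 2 ≤ p → 2 ≤ q →
  ∀ {a b} → left p a ≡ true → left p b ≡ false → η p q G ≤ count (breaksOnly (K p q) G a b) (allMaps (p + q) n)
η≤count-breaksOnly {n} {p@(suc (suc _))} {q@(suc (suc _))} G (s≤s (s≤s _)) (s≤s (s≤s _)) {a} {b} a-left b-right =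
  ≤-trans (η≤ηUnrestricted p q G) (by-size (≤-total q p))
  where
  maps : List (Vec (Fin n) (p + q))
  maps = allMaps (p + q) n
  by-size : q ≤ p ⊎ p ≤ q → ηUnrestricted (p ⊔ q ∸ 1) G ≤ count (breaksOnly (K p q) G a b) maps
  by-size (inj₁ q≤p)
    with witness-avoiding {P = left p} ((λ ()) ∘ ↑ʳ-injective p zero (suc zero))
                          (left-↑ʳ p zero) (left-↑ʳ p (suc zero)) b
  ... | b′ , b′-right , b′≢b =
    subst (λ m → ηUnrestricted (m ∸ 1) G ≤ count (breaksOnly (K p q) G a b) maps)
          (trans (count-left p q) (sym (m≥n⇒m⊔n≡m q≤p)))
          (ηUnrestricted≤count-breaksOnly G {K p q} (left p) (λ i j → xor-true⁻) a-left b-right b′-right b′≢b)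
  by-size (inj₂ p≤q)
    with witness-avoiding {P = not ∘ left p} {x₁ = zero} {suc zero} (λ ()) refl refl a
  ... | a′ , a′-left , a′≢a =
    subst₂ (λ m c → ηUnrestricted (m ∸ 1) G ≤ c)
           (trans (count-right p q) (sym (m≤n⇒m⊔n≡n p≤q)))
           (count-cong maps (breaksOnly-sym (K p q) G b a))
           (ηUnrestricted≤count-breaksOnly G {K p q} (not ∘ left p) (λ i j → cong not ∘ xor-true⁻)
                                           (cong not b-right) (cong not a-left) a′-left a′≢a)

hom-subgraph-K-lower-bound : ∀ {p q} (F : Graph (p + q)) (G : Graph n) → SpanningSubgraph F (K p q) →
  2 ≤ p → 2 ≤ q → hom (K p q) G + (p * q ∸ edgeCount F) * η p q G ≤ hom F G
hom-subgraph-K-lower-bound {n} {p} {q} F G F⊆K 2≤p 2≤q = begin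
  hom (K p q) G + (p * q ∸ edgeCount F) * η p q G
    ≡⟨ cong (λ m → hom (K p q) G + m * η p q G) #missing≡ ⟩
  hom (K p q) G + ΣΣ (λ a b → [ missingKF a b ]ᵇ) * η p q G
    ≡⟨ cong (hom (K p q) G +_) (trans (sym (∑-*ʳ vs _ _)) (∑-cong vs λ a → sym (∑-*ʳ vs _ _))) ⟩
  hom (K p q) G + ΣΣ (λ a b → [ missingKF a b ]ᵇ * η p q G)
    ≤⟨ +-monoʳ-≤ (hom (K p q) G) (∑-mono vs λ a → ∑-mono vs λ b → []ᵇ*-mono (η≤count a b)) ⟩
  hom (K p q) G + ΣΣ (λ a b → [ missingKF a b ]ᵇ * count (breaksOnly (K p q) G a b) (allMaps (p + q) n))
    ≤⟨ hom-subgraph-lower-bound {F = F} {H = K p q} G F⊆K (leftToRight-orients p q) ⟩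
  hom F G  ∎
  where
  open ≤-Reasoning
  vs : List (Fin (p + q))
  vs = allFin (p + q)
  ΣΣ : (Fin (p + q) → Fin (p + q) → ℕ) → ℕ
  ΣΣ f = Σv (p + q) (λ a → Σv (p + q) (λ b → f a b))
  missingKF : Fin (p + q) → Fin (p + q) → Bool
  missingKF = missing (leftToRight p) (K p q) F
  #missing≡ : p * q ∸ edgeCount F ≡ ΣΣ (λ a b → [ missingKF a b ]ᵇ)
  #missing≡ = trans (cong (_∸ edgeCount F) (trans (sym (edgeCount-K p q)) K-missing)) (m+n∸m≡n (edgeCount F) _)
    where
    K-missing : edgeCount (K p q) ≡ edgeCount F + ΣΣ (λ a b → [ missingKF a b ]ᵇ)
    K-missing = edgeCount-missing {F = F} {K p q} F⊆K (leftToRight-orients p q)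
  η≤count : ∀ a b → missingKF a b ≡ true → η p q G ≤ count (breaksOnly (K p q) G a b) (allMaps (p + q) n)
  η≤count a b m with ∧-true⁻ (proj₁ (∧-true⁻ (proj₁ (∧-true⁻ m))))
  ... | a-left , b-right = η≤count-breaksOnly G 2≤p 2≤q a-left (not-true⁻ b-right)

unique-right-vertex : ∀ p (i : Fin (p + 1)) → left p i ≡ false → i ≡ p ↑ʳ zero
unique-right-vertex zero    zero    _ = refl
unique-right-vertex (suc p) (suc i) h = cong suc (unique-right-vertex p i h)

subgraph-K1q-isStar : ∀ {q} (F : Graph (1 + q)) → SpanningSubgraph F (K 1 q) → IsStar F zero
subgraph-K1q-isStar F F⊆K zero    v       _  = inj₁ refl
subgraph-K1q-isStar F F⊆K (suc u) zero    _  = inj₂ refl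
subgraph-K1q-isStar F F⊆K (suc u) (suc v) uv with F⊆K (suc u) (suc v) uv
... | ()

subgraph-Kp1-isStar : ∀ {p} (F : Graph (p + 1)) → SpanningSubgraph F (K p 1) → IsStar F (p ↑ʳ zero)
subgraph-Kp1-isStar {p} F F⊆K u v uv with left p v in v-left
... | false = inj₂ (unique-right-vertex p v v-left)
... | true  = inj₁ (unique-right-vertex p u (trans (xor-true⁻ (F⊆K u v uv)) (cong not v-left)))

corollary7 : (p q : ℕ) → 1 ≤ p → 1 ≤ q
    → (F : Graph (p + q)) → SpanningSubgraph F (K p q)
    → (n : ℕ) → (G : Graph n) → IsBipartite G
    → ((p ≥ 2 → q ≥ 2 → hom F G ≥ hom (K p q) G + (p * q ∸ edgeCount F) * η p q G)
      × ((p ≡ 1 ⊎ q ≡ 1) → hom F G ≡ n ^ (p * q ∸ edgeCount F) * Σv n (λ v → deg G v ^ edgeCount F)))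
corollary7 p q _ _ F F⊆K n G _ = hom-subgraph-K-lower-bound F G F⊆K , hom-K-star
  where
  Σdeg^e : ℕ
  Σdeg^e = Σv n (λ v → deg G v ^ edgeCount F)
  hom-K-star : p ≡ 1 ⊎ q ≡ 1 → hom F G ≡ n ^ (p * q ∸ edgeCount F) * Σdeg^e
  hom-K-star (inj₁ refl) = trans (hom-star F G (subgraph-K1q-isStar F F⊆K))
    (cong (λ m → n ^ (m ∸ edgeCount F) * Σdeg^e) (sym (*-identityˡ q)))
  hom-K-star (inj₂ refl) = trans (hom-star F G (subgraph-Kp1-isStar F F⊆K))
    (cong (λ m → n ^ (m ∸ edgeCount F) * Σdeg^e) (trans (m+n∸n≡m p 1) (sym (*-identityʳ p))))
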